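{- Let $\Sigma$ be a finite set of models, let $G$ be an undirected weighted graph on vertex set $\Sigma$ with positive edge lengths satisfying the feedback property described in the context, and let $s^*\in\Sigma$ be the unknown target. Assume all feedback is correct. Let $S_{\mathrm{init}}\subseteq\Sigma$ with $s^*\in S_{\mathrm{init}}$ and $N_0=|S_{\mathrm{init}}|$. Run the algorithm: $S\leftarrow S_{\mathrm{init}}$; while $|S|>1$, propose a model $s$ minimizing $\Phi_S(s)$ over all models, receive feedback $s'$, and set $S\leftarrow S\cap N(s,s')$; return the unique model in $S$. Then one may take $\beta=\frac12$ (i.e. each chosen $s$ has $\Phi_S(s)\le \frac12$), and the algorithm finds $s^*$ using at most $\log_2 N_0$ queries.
   Context: $G$ has one node per model and edges $(s,s')$ with positive lengths; distances are shortest-path distances. In each round the algorithm proposes $s$ and the user responds with $s'$. Correct feedback: if $s=s^*$ then $s'=s$; otherwise $s'\neq s$ is a neighbor of $s$ in $G$ lying on a shortest path from $s$ to $s^*$ (no guarantee which one). $N(s,s')=\{s\}$ if $s'=s$, and $N(s,s')=\{\hat s: s'\text{ lies on a shortest path from } s \text{ to } \hat s\}$ otherwise. For node weights $\mu\ge0$, $\mu(S)=\sum_{s\in S}\mu(s)$ and $\Phi_\mu(s)=\frac{1}{\mu(\Sigma)}\max_{s'\neq s,(s,s')\in G}\mu(N(s,s'))$; $\Phi_S(s)=\Phi_{\mu_S}(s)$ where $\mu_S$ is the indicator of $S$.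
   Formalization: The edge lengths of G take values in the positive rationals. -}

module Defs where

open import Data.Nat using (ℕ; zero; suc; _⊔_; _<_; _≤_)
open import Data.Fin using (Fin)
open import Data.Fin.Subset using (Subset; _∩_; ⁅_⁆; ∣_∣)
open import Data.Vec using (tabulate; foldr)
open import Data.Maybe using (Maybe; just; nothing)
open import Data.Bool using (Bool; true; false; if_then_else_)
open import Data.Integer using (+_)
open import Data.Rational using (ℚ; 0ℚ; _/_) renaming (_+_ to _+ℚ_; _≤_ to _≤ℚ_; _<_ to _<ℚ_)
open import Data.Rational.Properties using () renaming (_≟_ to _≟ℚ_)
open import Data.Fin.Properties using () renaming (_≟_ to _≟F_)
open import Data.Product using (Σ; _×_; ∃)
open import Relation.Nullary using (¬_; does)
open import Relation.Binary.PropositionalEquality using (_≡_; _≢_)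

-- An undirected graph on the model set Σ = Fin n with positive (rational)
-- edge lengths: w u v ≡ just ℓ iff (u,v) is an edge of length ℓ.
record WGraph (n : ℕ) : Set where
  field
    w      : Fin n → Fin n → Maybe ℚ
    w-sym  : ∀ u v → w u v ≡ w v u
    w-pos  : ∀ u v ℓ → w u v ≡ just ℓ → 0ℚ <ℚ ℓ
open WGraph public

module _ {n : ℕ} (G : WGraph n) where

  Edge : Fin n → Fin n → Set
  Edge u v = Σ ℚ λ ℓ → w G u v ≡ just ℓ

  isEdge : Fin n → Fin n → Bool
  isEdge u v with w G u v
  ... | just _  = true
  ... | nothing = false

  data Walk : Fin n → Fin n → ℚ → Set where
    here : ∀ u → Walk u u 0ℚ
    step : ∀ {u v t ℓ L} → w G u v ≡ just ℓ → Walk v t L → Walk u t (ℓ +ℚ L)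

  -- d is the shortest-path distance of G (in particular G is connected).
  IsShortestPathDist : (Fin n → Fin n → ℚ) → Set
  IsShortestPathDist d =
    ∀ u v → Walk u v (d u v) × (∀ L → Walk u v L → d u v ≤ℚ L)

module _ {n : ℕ} (G : WGraph n) (d : Fin n → Fin n → ℚ) where

  OnShortestPath : Fin n → Fin n → Fin n → Set
  OnShortestPath s s' t = d s s' +ℚ d s' t ≡ d s t

  N : Fin n → Fin n → Subset n
  N s s' = if does (s' ≟F s) then ⁅ s ⁆
           else tabulate (λ t → does ((d s s' +ℚ d s' t) ≟ℚ d s t))

  maxNb : Subset n → Fin n → ℕ
  maxNb S s = foldr (λ _ → ℕ) _⊔_ 0
    (tabulate (λ s' → if isEdge G s s' then
                        (if does (s' ≟F s) then 0 else ∣ S ∩ N s s' ∣)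
                      else 0))

  -- m / k as a rational, with the convention m / 0 = 0
  frac : ℕ → ℕ → ℚ
  frac m zero    = 0ℚ
  frac m (suc k) = (+ m) / suc k

  Φ : Subset n → Fin n → ℚ
  Φ S s = frac (maxNb S s) ∣ S ∣

  IsMinimizer : Subset n → Fin n → Set
  IsMinimizer S s = ∀ t → Φ S s ≤ℚ Φ S t

  CorrectFeedback : Fin n → Fin n → Fin n → Set
  CorrectFeedback s* s s' =
    (s ≡ s* → s' ≡ s) ×
    (s ≢ s* → s' ≢ s × Edge G s s' × OnShortestPath s s' s*)

  -- Trace s* S S' k : starting from candidate set S, the algorithm performs
  -- k rounds (each while |S| > 1, proposing a minimiser of Φ_S and receiving
  -- correct feedback) and reaches candidate set S'.
  data Trace (s* : Fin n) : Subset n → Subset n → ℕ → Set where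
    done : ∀ {S} → Trace s* S S 0
    step : ∀ {S S' k} (s s' : Fin n) →
           1 < ∣ S ∣ → IsMinimizer S s → CorrectFeedback s* s s' →
           Trace s* (S ∩ N s s') S' k → Trace s* S S' (suc k)

-- Let s₀ be a medoid of the candidate set S, i.e. a model minimising
-- ∑_{t ∈ S} d(s₀, t).  For an edge (s₀, s'), every t ∈ N(s₀, s') is exactly
-- δ = d(s₀, s') closer to s' than to s₀, while every other t is at most δ
-- farther.  Summing over S and comparing with ∑_{t ∈ S} d(s', t) shows that
-- at most half of S lies in N(s₀, s'), so Φ_S(s₀) ≤ ½ and hence every
-- minimiser s of Φ_S has Φ_S(s) ≤ ½.  Each round therefore at least halves
-- the candidate set, while correct feedback keeps s* in it; so after k
-- rounds 2^k ≤ N₀, and a candidate set of size at most one is {s*}.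
module Submission where

open import Defs
open import Algebra.Bundles using (CommutativeMonoid)
open import Data.Bool using (Bool; true; false; if_then_else_)
open import Data.Fin using (Fin; zero; suc)
open import Data.Fin.Properties using () renaming (_≟_ to _≟F_)
open import Data.Fin.Subset using (Subset; inside; outside; _∈_; _⊆_; _∩_; ∁; ⁅_⁆; ∣_∣)
open import Data.Fin.Subset.Properties
  using (_∈?_; x∈⁅x⁆; x∈⁅y⁆⇒x≡y; ∣⁅x⁆∣≡1; ⊆-antisym; p⊆q⇒∣p∣≤∣q∣; p⊂q⇒∣p∣<∣q∣;
         x∈p∩q⁺; x∈p∩q⁻; ∣p∩q∣≤∣q∣)
open import Data.Integer using (+_; +≤+) renaming (_≤_ to _≤ℤ_)
import Data.Integer.Properties as ℤ
open import Data.List using (allFin)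
open import Data.List.Membership.Propositional.Properties using (∈-allFin)
import Data.List.Relation.Unary.All as All
open import Data.Nat using (ℕ; zero; suc; _<_; _≤_; _+_; _*_; _^_; _⊔_; z≤n; s≤s; NonZero; >-nonZero)
import Data.Nat.Properties as ℕ
open import Data.Nat.Logarithm using (⌊log₂_⌋; ⌊log₂⌋-mono-≤; ⌊log₂[2^n]⌋≡n)
open import Data.Product using (_×_; _,_; proj₁; proj₂; ∃-syntax)
open import Data.Rational using (ℚ; ½; 0ℚ; -_; fromℚᵘ; +-0-rawMonoid)
  renaming (_+_ to _+ℚ_; _≤_ to _≤ℚ_; _<_ to _<ℚ_)
import Data.Rational.Properties as ℚ
open import Data.Rational.Unnormalised using (mkℚᵘ; *≤*) renaming (_≤_ to _≤ᵘ_)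
import Data.Rational.Unnormalised.Properties as ℚᵘ
open import Data.Vec using (_∷_; []; tabulate; foldr; here; there)
import Data.Vec.Properties as Vec
open import Function using (_∘_)
open import Function.Bundles using (_⇔_; mk⇔; Equivalence)
open import Relation.Binary.Bundles using (TotalOrder; DecTotalOrder)
open import Relation.Binary.PropositionalEquality
open import Relation.Nullary using (Dec; yes; no; does; contradiction)
open import Relation.Nullary.Decidable using (dec-true; dec-false)

open import Algebra.Definitions.RawMonoid +-0-rawMonoid using () renaming (_×_ to _·_)
open import Algebra.Properties.Group ℚ.+-0-group using (\\-leftDividesʳ)
open import Algebra.Properties.CommutativeSemigroup
  (CommutativeMonoid.commutativeSemigroup ℚ.+-0-commutativeMonoid) using (interchange)

open Equivalence using (to; from)

+-cancelˡ-≤ : ∀ r {p q} → r +ℚ p ≤ℚ r +ℚ q → p ≤ℚ q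
+-cancelˡ-≤ r {p} {q} r+p≤r+q =
  subst₂ _≤ℚ_ (\\-leftDividesʳ r p) (\\-leftDividesʳ r q) (ℚ.+-monoʳ-≤ (- r) r+p≤r+q)

·-nonNeg : ∀ c {δ} → 0ℚ ≤ℚ δ → 0ℚ ≤ℚ c · δ
·-nonNeg zero    _   = ℚ.≤-refl
·-nonNeg (suc c) 0≤δ = ℚ.+-mono-≤ 0≤δ (·-nonNeg c 0≤δ)

·-cancelʳ-≤ : ∀ c r {δ} → 0ℚ <ℚ δ → c · δ ≤ℚ r · δ → c ≤ r
·-cancelʳ-≤ zero    r       _   _ = z≤n
·-cancelʳ-≤ (suc c) zero    0<δ h =
  contradiction (ℚ.<-≤-trans (ℚ.+-mono-<-≤ 0<δ (·-nonNeg c (ℚ.<⇒≤ 0<δ))) h) (ℚ.<-irrefl refl)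
·-cancelʳ-≤ (suc c) (suc r) {δ} 0<δ h = s≤s (·-cancelʳ-≤ c r 0<δ (+-cancelˡ-≤ δ h))

fromℚᵘ-≤⇔ : ∀ p q → fromℚᵘ p ≤ℚ fromℚᵘ q ⇔ p ≤ᵘ q
fromℚᵘ-≤⇔ p q = mk⇔
  (λ h → ℚᵘ.≤-respˡ-≃ (ℚ.toℚᵘ-fromℚᵘ p) (ℚᵘ.≤-respʳ-≃ (ℚ.toℚᵘ-fromℚᵘ q) (ℚ.toℚᵘ-mono-≤ h)))
  (λ h → ℚ.toℚᵘ-cancel-≤ (ℚᵘ.≤-respˡ-≃ (ℚᵘ.≃-sym (ℚ.toℚᵘ-fromℚᵘ p))
                           (ℚᵘ.≤-respʳ-≃ (ℚᵘ.≃-sym (ℚ.toℚᵘ-fromℚᵘ q)) h)))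

∃-argmin : ∀ {a ℓ₁ ℓ₂} (O : TotalOrder a ℓ₁ ℓ₂) {n} → Fin n →
           (f : Fin n → TotalOrder.Carrier O) → ∃[ s ] ∀ t → TotalOrder._≤_ O (f s) (f t)
∃-argmin O s f = argmin f s (allFin _) , λ t → All.lookup (f[argmin]≤f[xs] s (allFin _)) (∈-allFin t)
  where open import Data.List.Extrema O using (argmin; f[argmin]≤f[xs])

∈-tabulate⇔ : ∀ {m} (f : Fin m → Bool) t → t ∈ tabulate f ⇔ f t ≡ true
∈-tabulate⇔ f t = mk⇔
  (λ t∈ → trans (sym (Vec.lookup∘tabulate f t)) (Vec.[]=⇒lookup t∈))
  (λ ft → Vec.lookup⇒[]= t (tabulate f) (trans (Vec.lookup∘tabulate f t) ft))

does≡true⇔ : ∀ {P : Set} (P? : Dec P) → does P? ≡ true ⇔ P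
does≡true⇔ (yes p) = mk⇔ (λ _ → p) (λ _ → refl)
does≡true⇔ (no ¬p) = mk⇔ (λ ()) (λ p → contradiction p ¬p)

∣p∩q∣+∣p∩∁q∣≡∣p∣ : ∀ {m} (p q : Subset m) → ∣ p ∩ q ∣ + ∣ p ∩ ∁ q ∣ ≡ ∣ p ∣
∣p∩q∣+∣p∩∁q∣≡∣p∣ []            []            = refl
∣p∩q∣+∣p∩∁q∣≡∣p∣ (outside ∷ p) (_       ∷ q) = ∣p∩q∣+∣p∩∁q∣≡∣p∣ p q
∣p∩q∣+∣p∩∁q∣≡∣p∣ (inside  ∷ p) (inside  ∷ q) = cong suc (∣p∩q∣+∣p∩∁q∣≡∣p∣ p q)
∣p∩q∣+∣p∩∁q∣≡∣p∣ (inside  ∷ p) (outside ∷ q) =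
  trans (ℕ.+-suc _ _) (cong suc (∣p∩q∣+∣p∩∁q∣≡∣p∣ p q))

x∈p⇒⁅x⁆⊆p : ∀ {m} {x : Fin m} {p} → x ∈ p → ⁅ x ⁆ ⊆ p
x∈p⇒⁅x⁆⊆p {x = x} {p} x∈p y∈⁅x⁆ = subst (_∈ p) (sym (x∈⁅y⁆⇒x≡y x y∈⁅x⁆)) x∈p

x∈p⇒1≤∣p∣ : ∀ {m} {x : Fin m} {p} → x ∈ p → 1 ≤ ∣ p ∣
x∈p⇒1≤∣p∣ {x = x} x∈p = subst (_≤ _) (∣⁅x⁆∣≡1 x) (p⊆q⇒∣p∣≤∣q∣ (x∈p⇒⁅x⁆⊆p x∈p))

x∈p∧∣p∣≤1⇒p≡⁅x⁆ : ∀ {m} {x : Fin m} {p} → x ∈ p → ∣ p ∣ ≤ 1 → p ≡ ⁅ x ⁆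
x∈p∧∣p∣≤1⇒p≡⁅x⁆ {x = x} {p} x∈p ∣p∣≤1 = ⊆-antisym p⊆⁅x⁆ (x∈p⇒⁅x⁆⊆p x∈p)
  where
  p⊆⁅x⁆ : p ⊆ ⁅ x ⁆
  p⊆⁅x⁆ {y} y∈p with y ∈? ⁅ x ⁆
  ... | yes y∈⁅x⁆ = y∈⁅x⁆
  ... | no  y∉⁅x⁆ = contradiction
    (ℕ.<-≤-trans (subst (_< ∣ p ∣) (∣⁅x⁆∣≡1 x) (p⊂q⇒∣p∣<∣q∣ (x∈p⇒⁅x⁆⊆p x∈p , y , y∈p , y∉⁅x⁆))) ∣p∣≤1)
    (ℕ.<-irrefl refl)

∑ : ∀ {m} → Subset m → (Fin m → ℚ) → ℚ
∑ []            f = 0ℚ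
∑ (inside  ∷ S) f = f zero +ℚ ∑ S (f ∘ suc)
∑ (outside ∷ S) f = ∑ S (f ∘ suc)

∑-shift : ∀ {m} (S M : Subset m) (f g : Fin m → ℚ) δ →
          (∀ {t} → t ∈ S ∩ M → g t +ℚ δ ≤ℚ f t) →
          (∀ {t} → t ∈ S ∩ ∁ M → g t ≤ℚ f t +ℚ δ) →
          ∑ S g +ℚ ∣ S ∩ M ∣ · δ ≤ℚ ∑ S f +ℚ ∣ S ∩ ∁ M ∣ · δ
∑-shift []            []            f g δ closer farther = ℚ.≤-refl
∑-shift (outside ∷ S) (_       ∷ M) f g δ closer farther =
  ∑-shift S M (f ∘ suc) (g ∘ suc) δ (closer ∘ there) (farther ∘ there)
∑-shift (inside  ∷ S) (inside  ∷ M) f g δ closer farther = begin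
  (g zero +ℚ ∑ S (g ∘ suc)) +ℚ (δ +ℚ ∣ S ∩ M ∣ · δ) ≡⟨ interchange (g zero) _ δ _ ⟩
  (g zero +ℚ δ) +ℚ (∑ S (g ∘ suc) +ℚ ∣ S ∩ M ∣ · δ)  ≤⟨ ℚ.+-mono-≤ (closer here) rest ⟩
  f zero +ℚ (∑ S (f ∘ suc) +ℚ ∣ S ∩ ∁ M ∣ · δ)       ≡⟨ ℚ.+-assoc (f zero) _ _ ⟨
  (f zero +ℚ ∑ S (f ∘ suc)) +ℚ ∣ S ∩ ∁ M ∣ · δ       ∎
  where
  open ℚ.≤-Reasoning
  rest : ∑ S (g ∘ suc) +ℚ ∣ S ∩ M ∣ · δ ≤ℚ ∑ S (f ∘ suc) +ℚ ∣ S ∩ ∁ M ∣ · δ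
  rest = ∑-shift S M (f ∘ suc) (g ∘ suc) δ (closer ∘ there) (farther ∘ there)
∑-shift (inside  ∷ S) (outside ∷ M) f g δ closer farther = begin
  (g zero +ℚ ∑ S (g ∘ suc)) +ℚ ∣ S ∩ M ∣ · δ         ≡⟨ ℚ.+-assoc (g zero) _ _ ⟩
  g zero +ℚ (∑ S (g ∘ suc) +ℚ ∣ S ∩ M ∣ · δ)         ≤⟨ ℚ.+-mono-≤ (farther here) rest ⟩
  (f zero +ℚ δ) +ℚ (∑ S (f ∘ suc) +ℚ ∣ S ∩ ∁ M ∣ · δ) ≡⟨ interchange (f zero) δ _ _ ⟩
  (f zero +ℚ ∑ S (f ∘ suc)) +ℚ (δ +ℚ ∣ S ∩ ∁ M ∣ · δ) ∎
  where
  open ℚ.≤-Reasoning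
  rest : ∑ S (g ∘ suc) +ℚ ∣ S ∩ M ∣ · δ ≤ℚ ∑ S (f ∘ suc) +ℚ ∣ S ∩ ∁ M ∣ · δ
  rest = ∑-shift S M (f ∘ suc) (g ∘ suc) δ (closer ∘ there) (farther ∘ there)

⨆ : ∀ {m} → (Fin m → ℕ) → ℕ
⨆ f = foldr (λ _ → ℕ) _⊔_ 0 (tabulate f)

f≤⨆f : ∀ {m} (f : Fin m → ℕ) i → f i ≤ ⨆ f
f≤⨆f f zero    = ℕ.m≤m⊔n _ _
f≤⨆f f (suc i) = ℕ.≤-trans (f≤⨆f (f ∘ suc) i) (ℕ.m≤n⊔m _ _)

*-⨆-lub : ∀ {m} c (f : Fin m → ℕ) {X} → (∀ i → c * f i ≤ X) → c * ⨆ f ≤ X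
*-⨆-lub {zero}  c f {X} h = subst (_≤ X) (sym (ℕ.*-zeroʳ c)) z≤n
*-⨆-lub {suc m} c f h = subst (_≤ _) (sym (ℕ.*-distribˡ-⊔ c (f zero) _))
  (ℕ.⊔-lub (h zero) (*-⨆-lub c (f ∘ suc) (h ∘ suc)))

module _ {n} (G : WGraph n) where

  walk-++ : ∀ {u v t L M} → Walk G u v L → Walk G v t M → Walk G u t (L +ℚ M)
  walk-++ (here u) q = subst (Walk G _ _) (sym (ℚ.+-identityˡ _)) q
  walk-++ (step {ℓ = ℓ} {L = L} e p) q =
    subst (Walk G _ _) (sym (ℚ.+-assoc ℓ L _)) (step e (walk-++ p q))

  walk-reverse : ∀ {u v L} → Walk G u v L → Walk G v u L
  walk-reverse (here u) = here u
  walk-reverse (step {u} {v} {t} {ℓ} {L} e p) =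
    subst (Walk G t u) (ℚ.+-comm L ℓ)
      (walk-++ (walk-reverse p)
        (subst (Walk G v u) (ℚ.+-identityʳ ℓ) (step (trans (w-sym G v u) e) (here u))))

  walk-nonNeg : ∀ {u v L} → Walk G u v L → 0ℚ ≤ℚ L
  walk-nonNeg (here u) = ℚ.≤-refl
  walk-nonNeg (step {u} {v} {ℓ = ℓ} e p) =
    ℚ.+-mono-≤ (ℚ.<⇒≤ (w-pos G u v ℓ e)) (walk-nonNeg p)

  walk-pos : ∀ {u v L} → Walk G u v L → u ≢ v → 0ℚ <ℚ L
  walk-pos (here u) u≢u = contradiction refl u≢u
  walk-pos (step {u} {v} {ℓ = ℓ} e p) _ =
    ℚ.+-mono-<-≤ (w-pos G u v ℓ e) (walk-nonNeg p)

module _ {n} (G : WGraph n) (d : Fin n → Fin n → ℚ) where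

  Beyond : Fin n → Fin n → Subset n
  Beyond s s' = tabulate (λ t → does ((d s s' +ℚ d s' t) ℚ.≟ d s t))

  N-refl : ∀ s → N G d s s ≡ ⁅ s ⁆
  N-refl s = cong (λ b → if b then ⁅ s ⁆ else Beyond s s) (dec-true (s ≟F s) refl)

  ∈N⇔ : ∀ {s s' t} → s' ≢ s → t ∈ N G d s s' ⇔ OnShortestPath G d s s' t
  ∈N⇔ {s} {s'} {t} s'≢s = mk⇔
    (to (does≡true⇔ (_ ℚ.≟ _)) ∘ to (∈-tabulate⇔ _ t) ∘ subst (t ∈_) N≡)
    (subst (t ∈_) (sym N≡) ∘ from (∈-tabulate⇔ _ t) ∘ from (does≡true⇔ (_ ℚ.≟ _)))
    where
    N≡ : N G d s s' ≡ Beyond s s'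
    N≡ = cong (λ b → if b then ⁅ s ⁆ else Beyond s s') (dec-false (s' ≟F s) s'≢s)

  -- maxNb G d S s is definitionally ⨆ (nbEntry S s).
  nbEntry : Subset n → Fin n → Fin n → ℕ
  nbEntry S s s' = if isEdge G s s' then (if does (s' ≟F s) then 0 else ∣ S ∩ N G d s s' ∣) else 0

  maxNb-≥ : ∀ S {s s'} → Edge G s s' → s' ≢ s → ∣ S ∩ N G d s s' ∣ ≤ maxNb G d S s
  maxNb-≥ S {s} {s'} (ℓ , e) s'≢s = subst (_≤ maxNb G d S s) entry≡ (f≤⨆f (nbEntry S s) s')
    where
    entry≡ : nbEntry S s s' ≡ ∣ S ∩ N G d s s' ∣
    entry≡ rewrite e | dec-false (s' ≟F s) s'≢s = refl

  maxNb-lub : ∀ S s c {X} → (∀ {s'} → s' ≢ s → c * ∣ S ∩ N G d s s' ∣ ≤ X) → c * maxNb G d S s ≤ X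
  maxNb-lub S s c {X} h = *-⨆-lub c (nbEntry S s) entry-bound
    where
    entry-bound : ∀ s' → c * nbEntry S s s' ≤ X
    entry-bound s' with isEdge G s s' | s' ≟F s | h {s'}
    ... | false | _        | _      = subst (_≤ X) (sym (ℕ.*-zeroʳ c)) z≤n
    ... | true  | yes _    | _      = subst (_≤ X) (sym (ℕ.*-zeroʳ c)) z≤n
    ... | true  | no s'≢s | bound = bound s'≢s

  frac≤½⇔ : ∀ m k .{{_ : NonZero k}} → frac G d m k ≤ℚ ½ ⇔ 2 * m ≤ k
  frac≤½⇔ m (suc k) = mk⇔ (cleared ∘ to (fromℚᵘ-≤⇔ _ _)) (from (fromℚᵘ-≤⇔ _ _) ∘ uncleared)
    where
    cleared : mkℚᵘ (+ m) k ≤ᵘ mkℚᵘ (+ 1) 1 → 2 * m ≤ suc k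
    cleared (*≤* h) = subst₂ _≤_ (ℕ.*-comm m 2) (ℕ.*-identityˡ (suc k))
      (ℤ.drop‿+≤+ (subst₂ _≤ℤ_ (sym (ℤ.pos-* m 2)) (sym (ℤ.pos-* 1 (suc k))) h))
    uncleared : 2 * m ≤ suc k → mkℚᵘ (+ m) k ≤ᵘ mkℚᵘ (+ 1) 1
    uncleared h = *≤* (subst₂ _≤ℤ_ (ℤ.pos-* m 2) (ℤ.pos-* 1 (suc k))
      (+≤+ (subst₂ _≤_ (ℕ.*-comm 2 m) (sym (ℕ.*-identityˡ (suc k))) h)))

  IsMedoid : Subset n → Fin n → Set
  IsMedoid S s₀ = ∀ t → ∑ S (d s₀) ≤ℚ ∑ S (d t)

  ∃-medoid : ∀ S → Fin n → ∃[ s₀ ] IsMedoid S s₀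
  ∃-medoid S s = ∃-argmin (DecTotalOrder.totalOrder ℚ.≤-decTotalOrder) s (λ t → ∑ S (d t))

  module _ (sp : IsShortestPathDist G d) where

    d-triangle : ∀ u v t → d u t ≤ℚ d u v +ℚ d v t
    d-triangle u v t = proj₂ (sp u t) _ (walk-++ G (proj₁ (sp u v)) (proj₁ (sp v t)))

    d-sym : ∀ u v → d u v ≡ d v u
    d-sym u v = ℚ.≤-antisym (shorter v u) (shorter u v)
      where
      shorter : ∀ u v → d v u ≤ℚ d u v
      shorter u v = proj₂ (sp v u) _ (walk-reverse G (proj₁ (sp u v)))

    d-pos : ∀ {u v} → u ≢ v → 0ℚ <ℚ d u v
    d-pos {u} {v} = walk-pos G (proj₁ (sp u v))

    medoid-halves : ∀ S {s₀ s'} → IsMedoid S s₀ → s' ≢ s₀ → 2 * ∣ S ∩ N G d s₀ s' ∣ ≤ ∣ S ∣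
    medoid-halves S {s₀} {s'} medoid s'≢s₀ = begin
      2 * ∣ S ∩ M ∣          ≡⟨ cong (_+_ ∣ S ∩ M ∣) (ℕ.+-identityʳ _) ⟩
      ∣ S ∩ M ∣ + ∣ S ∩ M ∣   ≤⟨ ℕ.+-monoʳ-≤ ∣ S ∩ M ∣ in≤out ⟩
      ∣ S ∩ M ∣ + ∣ S ∩ ∁ M ∣ ≡⟨ ∣p∩q∣+∣p∩∁q∣≡∣p∣ S M ⟩
      ∣ S ∣                  ∎
      where
      open ℕ.≤-Reasoning
      M : Subset n
      M = N G d s₀ s'
      δ : ℚ
      δ = d s₀ s'
      closer : ∀ {t} → t ∈ S ∩ M → d s' t +ℚ δ ≤ℚ d s₀ t
      closer t∈ = ℚ.≤-reflexive
        (trans (ℚ.+-comm _ δ) (to (∈N⇔ s'≢s₀) (proj₂ (x∈p∩q⁻ S M t∈))))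
      farther : ∀ {t} → t ∈ S ∩ ∁ M → d s' t ≤ℚ d s₀ t +ℚ δ
      farther {t} _ = subst (d s' t ≤ℚ_) (trans (cong (_+ℚ d s₀ t) (d-sym s' s₀)) (ℚ.+-comm δ _))
        (d-triangle s' s₀ t)
      in≤out : ∣ S ∩ M ∣ ≤ ∣ S ∩ ∁ M ∣
      in≤out = ·-cancelʳ-≤ _ _ (d-pos (s'≢s₀ ∘ sym)) (+-cancelˡ-≤ (∑ S (d s'))
        (ℚ.≤-trans (∑-shift S M (d s₀) (d s') δ closer farther)
                   (ℚ.+-monoˡ-≤ (∣ S ∩ ∁ M ∣ · δ) (medoid s'))))

    minimizer-Φ≤½ : ∀ S s .{{_ : NonZero ∣ S ∣}} → IsMinimizer G d S s → Φ G d S s ≤ℚ ½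
    minimizer-Φ≤½ S s minimizer =
      let s₀ , medoid = ∃-medoid S s
      in  ℚ.≤-trans (minimizer s₀) (from (frac≤½⇔ _ ∣ S ∣) (maxNb-lub S s₀ 2 (medoid-halves S medoid)))

    minimizer-halves : ∀ S s {s'} → 1 < ∣ S ∣ → IsMinimizer G d S s → Edge G s s' → s' ≢ s →
                       2 * ∣ S ∩ N G d s s' ∣ ≤ ∣ S ∣
    minimizer-halves S s 1<∣S∣ minimizer edge s'≢s =
      ℕ.≤-trans (ℕ.*-monoʳ-≤ 2 (maxNb-≥ S edge s'≢s)) (to (frac≤½⇔ _ ∣ S ∣) (minimizer-Φ≤½ S s minimizer))
      where instance _ = >-nonZero (ℕ.m<n⇒0<n 1<∣S∣)

    module _ (s* : Fin n) where

      feedback-keeps-target : ∀ {s s'} → CorrectFeedback G d s* s s' → s* ∈ N G d s s'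
      feedback-keeps-target {s} {s'} (on-target , off-target) with s ≟F s*
      ... | yes refl rewrite on-target refl = subst (s ∈_) (sym (N-refl s)) (x∈⁅x⁆ s)
      ... | no s≢s* = from (∈N⇔ (proj₁ (off-target s≢s*))) (proj₂ (proj₂ (off-target s≢s*)))

      feedback-halves : ∀ S s {s'} → 1 < ∣ S ∣ → IsMinimizer G d S s → CorrectFeedback G d s* s s' →
                        2 * ∣ S ∩ N G d s s' ∣ ≤ ∣ S ∣
      feedback-halves S s {s'} 1<∣S∣ minimizer (on-target , off-target) with s ≟F s*
      ... | yes s≡s* rewrite on-target s≡s* | N-refl s =
        ℕ.≤-trans (ℕ.*-monoʳ-≤ 2 (subst (∣ S ∩ ⁅ s ⁆ ∣ ≤_) (∣⁅x⁆∣≡1 s) (∣p∩q∣≤∣q∣ S ⁅ s ⁆))) 1<∣S∣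
      ... | no s≢s* with off-target s≢s*
      ... | s'≢s , edge , _ = minimizer-halves S s 1<∣S∣ minimizer edge s'≢s

      Trace-keeps-target : ∀ {S S' k} → Trace G d s* S S' k → s* ∈ S → s* ∈ S'
      Trace-keeps-target done                    s*∈S = s*∈S
      Trace-keeps-target (step s s' _ _ fb trace) s*∈S =
        Trace-keeps-target trace (x∈p∩q⁺ (s*∈S , feedback-keeps-target fb))

      Trace-halves : ∀ {S S' k} → Trace G d s* S S' k → 2 ^ k * ∣ S' ∣ ≤ ∣ S ∣
      Trace-halves done = ℕ.≤-reflexive (ℕ.*-identityˡ _)
      Trace-halves {S} {S'} {suc k} (step s s' 1<∣S∣ minimizer fb trace) = begin
        2 * 2 ^ k * ∣ S' ∣         ≡⟨ ℕ.*-assoc 2 (2 ^ k) _ ⟩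
        2 * (2 ^ k * ∣ S' ∣)       ≤⟨ ℕ.*-monoʳ-≤ 2 (Trace-halves trace) ⟩
        2 * ∣ S ∩ N G d s s' ∣     ≤⟨ feedback-halves S s 1<∣S∣ minimizer fb ⟩
        ∣ S ∣                      ∎
        where open ℕ.≤-Reasoning

      Trace-length≤⌊log₂⌋ : ∀ {S S' k} → Trace G d s* S S' k → s* ∈ S → k ≤ ⌊log₂ ∣ S ∣ ⌋
      Trace-length≤⌊log₂⌋ {S} {S'} {k} trace s*∈S =
        subst (_≤ ⌊log₂ ∣ S ∣ ⌋) (⌊log₂[2^n]⌋≡n k) (⌊log₂⌋-mono-≤ 2^k≤∣S∣)
        where
        2^k≤∣S∣ : 2 ^ k ≤ ∣ S ∣
        2^k≤∣S∣ = ℕ.≤-trans (ℕ.≤-reflexive (sym (ℕ.*-identityʳ (2 ^ k))))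
          (ℕ.≤-trans (ℕ.*-monoʳ-≤ (2 ^ k) (x∈p⇒1≤∣p∣ (Trace-keeps-target trace s*∈S)))
                     (Trace-halves trace))

corollary1 : ∀ {n} (G : WGraph n) (d : Fin n → Fin n → ℚ) → IsShortestPathDist G d →
    (s* : Fin n) (Sinit : Subset n) → s* ∈ Sinit →
    (∀ {S k} → Trace G d s* Sinit S k → 1 < ∣ S ∣ →
       ∀ s → IsMinimizer G d S s → Φ G d S s ≤ℚ ½)
    × (∀ {S k} → Trace G d s* Sinit S k → k ≤ ⌊log₂ ∣ Sinit ∣ ⌋)
    × (∀ {S k} → Trace G d s* Sinit S k → ∣ S ∣ ≤ 1 → S ≡ ⁅ s* ⁆)
corollary1 G d sp s* Sinit s*∈Sinit =
    (λ {S} _ 1<∣S∣ s minimizer → minimizer-Φ≤½ G d sp S s {{>-nonZero (ℕ.m<n⇒0<n 1<∣S∣)}} minimizer)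
  , (λ trace → Trace-length≤⌊log₂⌋ G d sp s* trace s*∈Sinit)
  , (λ trace ∣S∣≤1 → x∈p∧∣p∣≤1⇒p≡⁅x⁆ (Trace-keeps-target G d sp s* trace s*∈Sinit) ∣S∣≤1)
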